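{- Let $c,s$ be positive integers and let $G$ be a $(c,s)$-normal graph with exactly $N(c,s)$ vertices. If $(\mathcal C,\mathcal S)$ is a minimal $(c,s)$-normal cover of $G$, then every clique in $\mathcal C$ has exactly $c$ vertices and every stable set in $\mathcal S$ has exactly $s$ vertices.
   Context: A $(c,s)$-normal cover of a graph $G$ is a pair $(\mathcal C,\mathcal S)$ where $\mathcal C$ is a set of cliques of size at most $c$ covering all vertices, $\mathcal S$ is a set of stable sets of size at most $s$ covering all vertices, and every clique in $\mathcal C$ meets every stable set in $\mathcal S$. A graph is $(c,s)$-normal if it admits such a cover; $N(c,s)$ is the maximum number of vertices of a $(c,s)$-normal graph. The cover is minimal if no proper subset of $\mathcal C$ covers $V(G)$ and no proper subset of $\mathcal S$ covers $V(G)$. -}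

module Defs where

open import Data.Nat using (ℕ; _≤_)
open import Data.Fin using (Fin)
open import Data.Fin.Subset using (Subset; _∈_; _∉_; ∣_∣)
open import Data.Product using (Σ; ∃; _×_; _,_)
open import Relation.Nullary using (¬_)
open import Relation.Binary.PropositionalEquality using (_≡_; _≢_)
open import Level using (0ℓ)

record Graph (n : ℕ) : Set₁ where
  field
    Adj     : Fin n → Fin n → Set
    sym     : ∀ {x y} → Adj x y → Adj y x
    irrefl  : ∀ {x} → ¬ Adj x x
open Graph public

IsClique : ∀ {n} → Graph n → Subset n → Set
IsClique G X = ∀ x y → x ∈ X → y ∈ X → x ≢ y → Adj G x y

IsStable : ∀ {n} → Graph n → Subset n → Set
IsStable G X = ∀ x y → x ∈ X → y ∈ X → x ≢ y → ¬ Adj G x y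

-- A family (set) of vertex subsets, given by its membership predicate.
-- (It is automatically finite, since Subset n is finite.)
Family : ℕ → Set₁
Family n = Subset n → Set

Covers : ∀ {n} → Family n → Set
Covers {n} F = ∀ (v : Fin n) → ∃ λ X → F X × v ∈ X

Meets : ∀ {n} → Subset n → Subset n → Set
Meets X Y = ∃ λ v → v ∈ X × v ∈ Y

ProperSub : ∀ {n} → Family n → Family n → Set
ProperSub F' F = (∀ X → F' X → F X) × (∃ λ X → F X × ¬ F' X)

record NormalCover {n} (G : Graph n) (c s : ℕ) : Set₁ where
  field
    𝒞 : Family n
    𝒮 : Family n
    𝒞-clique : ∀ X → 𝒞 X → IsClique G X × ∣ X ∣ ≤ c
    𝒮-stable : ∀ X → 𝒮 X → IsStable G X × ∣ X ∣ ≤ s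
    𝒞-covers : Covers 𝒞
    𝒮-covers : Covers 𝒮
    meet : ∀ X Y → 𝒞 X → 𝒮 Y → Meets X Y
open NormalCover public

IsNormal : ∀ {n} → Graph n → ℕ → ℕ → Set₁
IsNormal G c s = NormalCover G c s

IsMinimal : ∀ {n} {G : Graph n} {c s : ℕ} → NormalCover G c s → Set₁
IsMinimal {n} K =
  (∀ (F : Family n) → ProperSub F (𝒞 K) → ¬ Covers F) ×
  (∀ (F : Family n) → ProperSub F (𝒮 K) → ¬ Covers F)

-- n = N(c,s): some (c,s)-normal graph has n vertices, and every
-- (c,s)-normal graph has at most n vertices.
IsMaxNormalOrder : ℕ → ℕ → ℕ → Set₁
IsMaxNormalOrder c s n =
  (Σ (Graph n) λ G → IsNormal G c s) ×
  (∀ m (H : Graph m) → IsNormal H c s → m ≤ n)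

module Submission where

-- Suppose some clique X of a minimal (c,s)-normal cover K of a
-- graph G on N(c,s) vertices had fewer than c vertices.  By minimality, X is
-- not redundant in 𝒞, so some vertex x lies in X and in no other member of
-- 𝒞 (constructively we only obtain this vertex under a double negation,
-- which suffices to derive a contradiction).  Add a new vertex z adjacent
-- exactly to X; replace X by X ∪ {z} among the cliques and add the stable
-- set (S ∖ {x}) ∪ {z}, where S ∈ 𝒮 contains x.  This is a (c,s)-normal
-- cover of a graph on N(c,s) + 1 vertices, which is impossible.
--
-- The statement for stable sets is the
-- same statement applied to the complement graph, whose cliques and stable
-- sets are the stable sets and cliques of G.

open import Defs
open import Data.Nat using (ℕ; _≤_; _<_; _≟_; suc)
open import Data.Nat.Properties using (≤-trans; ≤∧≢⇒<; n<1+n; <⇒≱)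
open import Data.Fin using (Fin; zero; suc)
open import Data.Fin.Subset using (Subset; ∣_∣; _∈_; _∉_; _─_; _-_; inside; outside)
open import Data.Fin.Subset.Properties using (p─q⊆p; x∈⁅x⁆; x∈p∧x≢y⇒x∈p-y; x∈p⇒∣p-x∣<∣p∣)
open import Data.Vec using (_∷_; here; there)
open import Data.Vec.Properties using (≡-dec)
import Data.Bool as Bool
open import Data.Product using (_×_; _,_; proj₁; proj₂; ∃)
open import Data.Empty using (⊥; ⊥-elim)
open import Data.Fin.Properties using (sequence)
open import Effect.Monad using (RawMonad)
open import Function using (_∘_)
open import Relation.Nullary using (¬_; Dec; yes; no)
open import Relation.Nullary.Negation using (¬¬-Monad)
open import Relation.Binary.PropositionalEquality using (_≡_; _≢_; refl; cong; ≢-sym)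

_≟ˢ_ : ∀ {n} (p q : Subset n) → Dec (p ≡ q)
_≟ˢ_ = ≡-dec Bool._≟_

∈─⇒∉ : ∀ {n} {v : Fin n} (p q : Subset n) → v ∈ p ─ q → v ∉ q
∈─⇒∉ (_ ∷ p) (outside ∷ q) (there v∈p─q) (there v∈q) = ∈─⇒∉ p q v∈p─q v∈q
∈─⇒∉ (_ ∷ p) (inside  ∷ q) (there v∈p─q) (there v∈q) = ∈─⇒∉ p q v∈p─q v∈q

∈-⇒≢ : ∀ {n} {v x : Fin n} (p : Subset n) → v ∈ p - x → v ≢ x
∈-⇒≢ {x = x} p v∈p-x refl = ∈─⇒∉ p _ v∈p-x (x∈⁅x⁆ x)

¬¬-∀ : ∀ {n} {P : Fin n → Set} → (∀ v → ¬ ¬ P v) → ¬ ¬ (∀ v → P v)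
¬¬-∀ = sequence (RawMonad.rawApplicative ¬¬-Monad)

-- The graph G ⊕ X on the vertex set {z} ∪ V(G) (z = zero, old vertex v =
-- suc v) obtained by adding a new vertex z whose neighbourhood is X.
module OneVertexExtension {n} (G : Graph n) (X : Subset n) where

  Adj⁺ : Fin (suc n) → Fin (suc n) → Set
  Adj⁺ zero    zero    = ⊥
  Adj⁺ zero    (suc v) = v ∈ X
  Adj⁺ (suc u) zero    = u ∈ X
  Adj⁺ (suc u) (suc v) = Adj G u v

  Adj⁺-sym : ∀ {u v} → Adj⁺ u v → Adj⁺ v u
  Adj⁺-sym {zero}  {suc v} v∈X = v∈X
  Adj⁺-sym {suc u} {zero}  u∈X = u∈X
  Adj⁺-sym {suc u} {suc v} uv  = Graph.sym G uv

  Adj⁺-irrefl : ∀ {u} → ¬ Adj⁺ u u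
  Adj⁺-irrefl {suc u} = Graph.irrefl G

_⊕_ : ∀ {n} → Graph n → Subset n → Graph (suc n)
G ⊕ X = record { Adj = Adj⁺ ; sym = λ {u} {v} → Adj⁺-sym {u} {v} ; irrefl = λ {u} → Adj⁺-irrefl {u} }
  where open OneVertexExtension G X

clique-⊕ : ∀ {n} {G : Graph n} {X Z : Subset n} → IsClique G Z → IsClique (G ⊕ X) (outside ∷ Z)
clique-⊕ Z-clique (suc u) (suc v) (there u∈Z) (there v∈Z) u≢v = Z-clique u v u∈Z v∈Z (u≢v ∘ cong suc)

stable-⊕ : ∀ {n} {G : Graph n} {X Y : Subset n} → IsStable G Y → IsStable (G ⊕ X) (outside ∷ Y)
stable-⊕ Y-stable (suc u) (suc v) (there u∈Y) (there v∈Y) u≢v = Y-stable u v u∈Y v∈Y (u≢v ∘ cong suc)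

cone-clique : ∀ {n} {G : Graph n} {X : Subset n} → IsClique G X → IsClique (G ⊕ X) (inside ∷ X)
cone-clique X-clique zero    zero    _           _           z≢z = ⊥-elim (z≢z refl)
cone-clique X-clique zero    (suc v) _           (there v∈X) _   = v∈X
cone-clique X-clique (suc u) zero    (there u∈X) _           _   = u∈X
cone-clique X-clique (suc u) (suc v) (there u∈X) (there v∈X) u≢v = X-clique u v u∈X v∈X (u≢v ∘ cong suc)

cone-stable : ∀ {n} {G : Graph n} {X Y : Subset n} → IsStable G Y → (∀ v → v ∈ Y → v ∉ X) →
              IsStable (G ⊕ X) (inside ∷ Y)
cone-stable Y-stable Y∩X=∅ zero    zero    _           _           z≢z = ⊥-elim (z≢z refl)
cone-stable Y-stable Y∩X=∅ zero    (suc v) _           (there v∈Y) _   = Y∩X=∅ v v∈Y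
cone-stable Y-stable Y∩X=∅ (suc u) zero    (there u∈Y) _           _   = Y∩X=∅ u u∈Y
cone-stable Y-stable Y∩X=∅ (suc u) (suc v) (there u∈Y) (there v∈Y) u≢v = Y-stable u v u∈Y v∈Y (u≢v ∘ cong suc)

meets-∷ : ∀ {n} {Z Y : Subset n} a b → Meets Z Y → Meets (a ∷ Z) (b ∷ Y)
meets-∷ _ _ (v , v∈Z , v∈Y) = suc v , there v∈Z , there v∈Y

Private : ∀ {n} → Family n → Subset n → Fin n → Set
Private F X x = x ∈ X × (∀ Z → F Z → x ∈ Z → Z ≡ X)

module ExtendedCover {n c s} {G : Graph n} (K : NormalCover G c s)
                     {X : Subset n} (X∈𝒞 : 𝒞 K X) (X-small : ∣ X ∣ < c)
                     {x : Fin n} (x-private : Private (𝒞 K) X x) where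

  x∈X : x ∈ X
  x∈X = proj₁ x-private

  X-clique : IsClique G X
  X-clique = proj₁ (𝒞-clique K X X∈𝒞)

  S : Subset n
  S = proj₁ (𝒮-covers K x)

  S∈𝒮 : 𝒮 K S
  S∈𝒮 = proj₁ (proj₂ (𝒮-covers K x))

  x∈S : x ∈ S
  x∈S = proj₂ (proj₂ (𝒮-covers K x))

  S-stable : IsStable G S
  S-stable = proj₁ (𝒮-stable K S S∈𝒮)

  -- Since x ∈ X ∩ S, the clique X and the stable set S meet only in x.
  S-x∩X=∅ : ∀ v → v ∈ S - x → v ∉ X
  S-x∩X=∅ v v∈S-x v∈X = S-stable x v x∈S v∈S x≢v (X-clique x v x∈X v∈X x≢v)
    where
    v∈S : v ∈ S
    v∈S = p─q⊆p S _ v∈S-x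
    x≢v : x ≢ v
    x≢v = ≢-sym (∈-⇒≢ S v∈S-x)

  meets-S-x : ∀ Z → 𝒞 K Z → Z ≢ X → Meets Z (S - x)
  meets-S-x Z Z∈𝒞 Z≢X with meet K Z S Z∈𝒞 S∈𝒮
  ... | v , v∈Z , v∈S = v , v∈Z , x∈p∧x≢y⇒x∈p-y v∈S v≢x
    where
    v≢x : v ≢ x
    v≢x refl = Z≢X (proj₂ x-private Z Z∈𝒞 v∈Z)

  𝒞⁺ : Family (suc n)
  𝒞⁺ (inside  ∷ Z) = Z ≡ X
  𝒞⁺ (outside ∷ Z) = 𝒞 K Z × Z ≢ X

  𝒮⁺ : Family (suc n)
  𝒮⁺ (inside  ∷ Y) = Y ≡ S - x
  𝒮⁺ (outside ∷ Y) = 𝒮 K Y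

  𝒞⁺-clique : ∀ Z → 𝒞⁺ Z → IsClique (G ⊕ X) Z × ∣ Z ∣ ≤ c
  𝒞⁺-clique (inside  ∷ Z) refl        = cone-clique X-clique , X-small
  𝒞⁺-clique (outside ∷ Z) (Z∈𝒞 , _) = clique-⊕ (proj₁ (𝒞-clique K Z Z∈𝒞)) , proj₂ (𝒞-clique K Z Z∈𝒞)

  𝒮⁺-stable : ∀ Y → 𝒮⁺ Y → IsStable (G ⊕ X) Y × ∣ Y ∣ ≤ s
  𝒮⁺-stable (inside  ∷ Y) refl =
    cone-stable (λ u v u∈ v∈ → S-stable u v (p─q⊆p S _ u∈) (p─q⊆p S _ v∈)) S-x∩X=∅ ,
    ≤-trans (x∈p⇒∣p-x∣<∣p∣ x∈S) (proj₂ (𝒮-stable K S S∈𝒮))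
  𝒮⁺-stable (outside ∷ Y) Y∈𝒮 = stable-⊕ (proj₁ (𝒮-stable K Y Y∈𝒮)) , proj₂ (𝒮-stable K Y Y∈𝒮)

  𝒞⁺-covers : Covers 𝒞⁺
  𝒞⁺-covers zero = inside ∷ X , refl , here
  𝒞⁺-covers (suc v) with 𝒞-covers K v
  ... | Z , Z∈𝒞 , v∈Z with Z ≟ˢ X
  ...   | yes refl = inside ∷ X , refl , there v∈Z
  ...   | no Z≢X   = outside ∷ Z , (Z∈𝒞 , Z≢X) , there v∈Z

  𝒮⁺-covers : Covers 𝒮⁺
  𝒮⁺-covers zero = inside ∷ (S - x) , refl , here
  𝒮⁺-covers (suc v) with 𝒮-covers K v
  ... | Y , Y∈𝒮 , v∈Y = outside ∷ Y , Y∈𝒮 , there v∈Y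

  𝒞⁺-meets-𝒮⁺ : ∀ Z Y → 𝒞⁺ Z → 𝒮⁺ Y → Meets Z Y
  𝒞⁺-meets-𝒮⁺ (inside  ∷ Z) (inside  ∷ Y) _           _    = zero , here , here
  𝒞⁺-meets-𝒮⁺ (inside  ∷ Z) (outside ∷ Y) refl        Y∈𝒮  = meets-∷ inside outside (meet K X Y X∈𝒞 Y∈𝒮)
  𝒞⁺-meets-𝒮⁺ (outside ∷ Z) (inside  ∷ Y) (Z∈𝒞 , Z≢X) refl = meets-∷ outside inside (meets-S-x Z Z∈𝒞 Z≢X)
  𝒞⁺-meets-𝒮⁺ (outside ∷ Z) (outside ∷ Y) (Z∈𝒞 , _)  Y∈𝒮  = meets-∷ outside outside (meet K Z Y Z∈𝒞 Y∈𝒮)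

  cover : NormalCover (G ⊕ X) c s
  cover = record
    { 𝒞 = 𝒞⁺ ; 𝒮 = 𝒮⁺ ; 𝒞-clique = 𝒞⁺-clique ; 𝒮-stable = 𝒮⁺-stable
    ; 𝒞-covers = 𝒞⁺-covers ; 𝒮-covers = 𝒮⁺-covers ; meet = 𝒞⁺-meets-𝒮⁺ }

-- A member X of a minimal covering family F is not redundant, so it has a
-- private vertex.  Without decidability of F we obtain it only under a
-- double negation: if no private vertex existed, F minus X would cover.
minimal-member-has-private-vertex :
  ∀ {n} (F : Family n) → Covers F → (∀ F′ → ProperSub F′ F → ¬ Covers F′) →
  ∀ {X} → F X → ¬ ¬ ∃ (Private F X)
minimal-member-has-private-vertex {n} F F-covers F-minimal {X} X∈F no-private =
  ¬¬-∀ covered-without-X (F-minimal F-X ((λ _ → proj₁) , X , X∈F , λ X∈F-X → proj₂ X∈F-X refl))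
  where
  F-X : Family n
  F-X Z = F Z × Z ≢ X

  -- A vertex covered by no member other than X would be private to X.
  covered-without-X : ∀ v → ¬ ¬ ∃ λ Z → F-X Z × v ∈ Z
  covered-without-X v uncovered = no-private (v , v∈X , only-X)
    where
    only-X : ∀ Z → F Z → v ∈ Z → Z ≡ X
    only-X Z Z∈F v∈Z with Z ≟ˢ X
    ... | yes Z≡X = Z≡X
    ... | no Z≢X  = ⊥-elim (uncovered (Z , (Z∈F , Z≢X) , v∈Z))
    v∈X : v ∈ X
    v∈X with F-covers v
    ... | Z , Z∈F , v∈Z with only-X Z Z∈F v∈Z
    ...   | refl = v∈Z

minimal-cliques-are-full :
  ∀ {c s n} → (∀ m (H : Graph m) → IsNormal H c s → m ≤ n) →
  (G : Graph n) (K : NormalCover G c s) → (∀ F → ProperSub F (𝒞 K) → ¬ Covers F) →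
  ∀ X → 𝒞 K X → ∣ X ∣ ≡ c
minimal-cliques-are-full {c} {n = n} order-bound G K 𝒞-minimal X X∈𝒞 with ∣ X ∣ ≟ c
... | yes ∣X∣≡c = ∣X∣≡c
... | no ∣X∣≢c  =
  ⊥-elim (minimal-member-has-private-vertex (𝒞 K) (𝒞-covers K) 𝒞-minimal X∈𝒞 no-private-vertex)
  where
  X-small : ∣ X ∣ < c
  X-small = ≤∧≢⇒< (proj₂ (𝒞-clique K X X∈𝒞)) ∣X∣≢c

  -- A private vertex would give a (c,s)-normal graph G ⊕ X on n + 1 vertices.
  no-private-vertex : ¬ ∃ (Private (𝒞 K) X)
  no-private-vertex (x , x-private) =
    <⇒≱ (n<1+n n) (order-bound (suc n) (G ⊕ X) (ExtendedCover.cover K X∈𝒞 X-small x-private))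

complement : ∀ {n} → Graph n → Graph n
complement G = record
  { Adj    = λ u v → u ≢ v × ¬ Adj G u v
  ; sym    = λ (u≢v , ¬uv) → ≢-sym u≢v , ¬uv ∘ Graph.sym G
  ; irrefl = λ (u≢u , _) → u≢u refl }

dual : ∀ {n} {G : Graph n} {c s} → NormalCover G c s → NormalCover (complement G) s c
dual K = record
  { 𝒞 = 𝒮 K ; 𝒮 = 𝒞 K
  ; 𝒞-clique = λ Y Y∈𝒮 → let (Y-stable , ∣Y∣≤s) = 𝒮-stable K Y Y∈𝒮 in
      (λ u v u∈Y v∈Y u≢v → u≢v , Y-stable u v u∈Y v∈Y u≢v) , ∣Y∣≤s
  ; 𝒮-stable = λ Z Z∈𝒞 → let (Z-clique , ∣Z∣≤c) = 𝒞-clique K Z Z∈𝒞 in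
      (λ u v u∈Z v∈Z u≢v (_ , ¬uv) → ¬uv (Z-clique u v u∈Z v∈Z u≢v)) , ∣Z∣≤c
  ; 𝒞-covers = 𝒮-covers K ; 𝒮-covers = 𝒞-covers K
  ; meet = λ Y Z Y∈𝒮 Z∈𝒞 → let (v , v∈Z , v∈Y) = meet K Z Y Z∈𝒞 Y∈𝒮 in v , v∈Y , v∈Z }

-- The theorem: cliques follow from the main lemma; stable sets from the
-- main lemma for the dual cover, since complements of (s,c)-normal graphs
-- are (c,s)-normal and so also have at most N(c,s) vertices.
claim2 : (c s : ℕ) → 0 < c → 0 < s → (n : ℕ) → IsMaxNormalOrder c s n →
         (G : Graph n) → (K : NormalCover G c s) → IsMinimal K →
         (∀ (X : Subset n) → 𝒞 K X → ∣ X ∣ ≡ c) × (∀ (Y : Subset n) → 𝒮 K Y → ∣ Y ∣ ≡ s)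
claim2 c s _ _ n (_ , order-bound) G K (𝒞-minimal , 𝒮-minimal) =
  minimal-cliques-are-full order-bound G K 𝒞-minimal ,
  minimal-cliques-are-full (λ m H K′ → order-bound m (complement H) (dual K′)) (complement G) (dual K) 𝒮-minimal
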